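{- Let $G^*$ be the graph with vertex set $\{1,\dots,9\}$ and the $14$ edges $\{i,i+1\}$ for $1\le i\le 8$, $\{9,1\}$, $\{1,6\}$, $\{2,5\}$, $\{3,7\}$, $\{4,9\}$, $\{5,8\}$. Then $G^*$ is equistarable but not strongly equistarable.
   Context: A star of a graph is the set $E(v)$ of all edges incident with a vertex $v$; it is maximal if not properly contained in another star. $\mathcal{S}^*(G)$ is the set of maximal stars and $\mathcal{T}^*(G)$ the set of all other nonempty subsets of $E(G)$. A graph $G=(V,E)$ without isolated vertices is equistarable if there is $\varphi:E\to\mathbb{R}_{>0}$ such that $F\subseteq E$ is a maximal star iff $\sum_{e\in F}\varphi(e)=1$. It is strongly equistarable if for each $T\in\mathcal{T}^*(G)$ and each real $\gamma\le1$ there is $\varphi:E\to\mathbb{R}_{>0}$ with $\sum_{e\in S}\varphi(e)=1$ for all $S\in\mathcal{S}^*(G)$ and $\sum_{e\in T}\varphi(e)\neq\gamma$.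
   Formalization: The weightings $\varphi$ take values in the positive rationals rather than the positive reals, and the parameter $\gamma$ ranges over the rationals instead of the reals. -}

module Defs where

open import Data.Nat using (ℕ)
open import Data.Bool using (Bool; true; false; if_then_else_; _∨_)
open import Data.Fin using (Fin; zero; suc; #_; _≟_)
open import Data.Fin.Subset using (Subset; _∈_; _⊂_; Nonempty)
open import Data.Vec using (Vec; []; _∷_; tabulate; lookup)
open import Data.Product using (Σ; ∃; _×_; _,_; proj₁; proj₂)
open import Data.Rational using (ℚ; 0ℚ; 1ℚ; _+_; _<_; _≤_)
open import Relation.Nullary using (¬_)
open import Relation.Nullary.Decidable using (isYes)
open import Relation.Binary.PropositionalEquality using (_≡_; _≢_)
open import Function.Bundles using (_⇔_)

record Graph : Set where
  field
    n    : ℕ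
    m    : ℕ
    ends : Fin m → Fin n × Fin n

open Graph public

incident : (G : Graph) → Fin (m G) → Fin (n G) → Bool
incident G e v = isYes (proj₁ (ends G e) ≟ v) ∨ isYes (proj₂ (ends G e) ≟ v)

star : (G : Graph) → Fin (n G) → Subset (m G)
star G v = tabulate (λ e → incident G e v)

NoIsolatedVertices : Graph → Set
NoIsolatedVertices G = ∀ v → Nonempty (star G v)

IsMaximalStar : (G : Graph) → Subset (m G) → Set
IsMaximalStar G F = Σ (Fin (n G)) λ v → (F ≡ star G v) × (∀ w → ¬ (star G v ⊂ star G w))

InTStar : (G : Graph) → Subset (m G) → Set
InTStar G T = Nonempty T × ¬ IsMaximalStar G T

sumOver : ∀ {k} → (Fin k → ℚ) → Subset k → ℚ
sumOver φ [] = 0ℚ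
sumOver φ (b ∷ F) = (if b then φ zero else 0ℚ) + sumOver (λ e → φ (suc e)) F

Positive : ∀ {k} → (Fin k → ℚ) → Set
Positive φ = ∀ e → 0ℚ < φ e

-- equistarable (weights taken in ℚ)
Equistarable : Graph → Set
Equistarable G =
  NoIsolatedVertices G ×
  Σ (Fin (m G) → ℚ) λ φ → Positive φ ×
    (∀ (F : Subset (m G)) → (IsMaximalStar G F ⇔ (sumOver φ F ≡ 1ℚ)))

StronglyEquistarable : Graph → Set
StronglyEquistarable G =
  NoIsolatedVertices G ×
  (∀ (T : Subset (m G)) → InTStar G T → ∀ (γ : ℚ) → γ ≤ 1ℚ →
     Σ (Fin (m G) → ℚ) λ φ → Positive φ ×
       (∀ (S : Subset (m G)) → IsMaximalStar G S → sumOver φ S ≡ 1ℚ) ×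
       (sumOver φ T ≢ γ))

-- Vertex i (1 ≤ i ≤ 9) of the paper is Fin index i-1.
G*edges : Vec (Fin 9 × Fin 9) 14
G*edges =
    (# 0 , # 1) ∷ (# 1 , # 2) ∷ (# 2 , # 3) ∷ (# 3 , # 4)
  ∷ (# 4 , # 5) ∷ (# 5 , # 6) ∷ (# 6 , # 7) ∷ (# 7 , # 8)
  ∷ (# 8 , # 0)
  ∷ (# 0 , # 5) ∷ (# 1 , # 4) ∷ (# 2 , # 6)
  ∷ (# 3 , # 8) ∷ (# 4 , # 7) ∷ []

G* : Graph
G* = record { n = 9 ; m = 14 ; ends = lookup G*edges }

{-# OPTIONS --safe #-}
module Submission where

-- The alternating sum E(1) − E(2) + E(3) − ⋯ + E(9) of the stars of G* counts
-- the edges {9,1} and {3,7} twice and every other edge zero times.  Hence any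
-- weighting giving every maximal star weight 1 gives T = {{9,1}, {3,7}} weight
-- exactly (5 − 4)/2 = 1/2, and T with γ = 1/2 witnesses that G* is not strongly
-- equistarable.  Equistarability is certified by explicit weights (in units of
-- 1/200), checked against all 2¹⁴ edge subsets.

open import Defs
open import Algebra.Bundles using (CommutativeRing)
open import Data.Bool using (true; false; if_then_else_)
open import Data.Fin using (Fin; zero; suc; #_)
open import Data.Fin.Properties using (any?; all?)
open import Data.Fin.Subset using (Subset; ⁅_⁆; _∪_)
open import Data.Fin.Subset.Properties using (_⊂?_; nonempty?; anySubset?)
open import Data.Integer using (+_)
open import Data.Nat using (ℕ)
open import Data.Product using (_×_; _,_)
open import Data.Rational using (ℚ; 0ℚ; 1ℚ; ½; -½; _/_; _+_; _*_; _≤_; _<?_; _≤?_)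
open import Data.Rational.Properties
  using (_≟_; *-identityˡ; *-identityʳ; *-zeroˡ; *-assoc; +-*-commutativeRing)
open import Data.Vec using (Vec; []; _∷_; lookup)
import Data.Vec.Properties as Vec
import Data.Bool.Properties as Bool
open import Function using (_∘_)
open import Function.Bundles using (mk⇔)
open import Relation.Nullary using (¬_; ¬?)
open import Relation.Nullary.Decidable
  using (_×-dec_; _→-dec_; from-yes; from-no; decidable-stable)
open import Relation.Nullary.Negation using (¬∃⟶∀¬)
open import Relation.Unary using (Decidable)
open import Relation.Binary.PropositionalEquality
  using (_≡_; refl; sym; cong; cong₂; module ≡-Reasoning)

open import Algebra.Properties.Semiring.Sum (CommutativeRing.semiring +-*-commutativeRing)
  using (sum-syntax; sum-cong-≗; ∑-comm; *-distribˡ-sum; *-distribʳ-sum)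

indicator : ∀ {k} → Subset k → Fin k → ℚ
indicator F e = if lookup F e then 1ℚ else 0ℚ

sumOver-∑ : ∀ {k} (φ : Fin k → ℚ) (F : Subset k) →
  sumOver φ F ≡ ∑[ e < k ] (indicator F e * φ e)
sumOver-∑ φ [] = refl
sumOver-∑ φ (b ∷ F) = cong₂ _+_ (select b) (sumOver-∑ (φ ∘ suc) F)
  where
  select : ∀ b → (if b then φ zero else 0ℚ) ≡ (if b then 1ℚ else 0ℚ) * φ zero
  select true  = sym (*-identityˡ (φ zero))
  select false = sym (*-zeroˡ (φ zero))

sumOver-linearCombination : ∀ {k n} (φ : Fin k → ℚ) (c : Fin n → ℚ) (S : Fin n → Subset k)
  (F : Subset k) → (∀ e → ∑[ v < n ] (c v * indicator (S v) e) ≡ indicator F e) →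
  sumOver φ F ≡ ∑[ v < n ] (c v * sumOver φ (S v))
sumOver-linearCombination {k} {n} φ c S F F≡∑cS = begin
  sumOver φ F
    ≡⟨ sumOver-∑ φ F ⟩
  ∑[ e < k ] (indicator F e * φ e)
    ≡⟨ sum-cong-≗ (λ e → cong (_* φ e) (sym (F≡∑cS e))) ⟩
  ∑[ e < k ] (∑[ v < n ] (c v * indicator (S v) e) * φ e)
    ≡⟨ sum-cong-≗ (λ e → *-distribʳ-sum (φ e) (λ v → c v * indicator (S v) e)) ⟩
  ∑[ e < k ] ∑[ v < n ] (c v * indicator (S v) e * φ e)
    ≡⟨ ∑-comm (λ e v → c v * indicator (S v) e * φ e) ⟩
  ∑[ v < n ] ∑[ e < k ] (c v * indicator (S v) e * φ e)
    ≡⟨ sum-cong-≗ (λ v → sum-cong-≗ (λ e → *-assoc (c v) (indicator (S v) e) (φ e))) ⟩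
  ∑[ v < n ] ∑[ e < k ] (c v * (indicator (S v) e * φ e))
    ≡⟨ sum-cong-≗ (λ v → sym (*-distribˡ-sum (c v) (λ e → indicator (S v) e * φ e))) ⟩
  ∑[ v < n ] (c v * ∑[ e < k ] (indicator (S v) e * φ e))
    ≡⟨ sum-cong-≗ (λ v → cong (c v *_) (sym (sumOver-∑ φ (S v)))) ⟩
  ∑[ v < n ] (c v * sumOver φ (S v))
    ∎
  where open ≡-Reasoning

starCombination⇒¬stronglyEquistarable : (G : Graph) (T : Subset (m G)) (c : Fin (n G) → ℚ) →
  InTStar G T → (∀ v → IsMaximalStar G (star G v)) →
  (∀ e → ∑[ v < n G ] (c v * indicator (star G v) e) ≡ indicator T e) →
  ∑[ v < n G ] c v ≤ 1ℚ → ¬ StronglyEquistarable G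
starCombination⇒¬stronglyEquistarable G T c T∈T* maximal T≡∑cE ∑c≤1 (_ , strong)
  with strong T T∈T* (∑[ v < n G ] c v) ∑c≤1
... | φ , _ , normalised , φT≢∑c = φT≢∑c (begin
  sumOver φ T
    ≡⟨ sumOver-linearCombination φ c (star G) T T≡∑cE ⟩
  ∑[ v < n G ] (c v * sumOver φ (star G v))
    ≡⟨ sum-cong-≗ (λ v → cong (c v *_) (normalised _ (maximal v))) ⟩
  ∑[ v < n G ] (c v * 1ℚ)
    ≡⟨ sum-cong-≗ (λ v → *-identityʳ (c v)) ⟩
  ∑[ v < n G ] c v
    ∎)
  where open ≡-Reasoning

isMaximalStar? : (G : Graph) → Decidable (IsMaximalStar G)
isMaximalStar? G F = any? λ v →
  Vec.≡-dec Bool._≟_ F (star G v) ×-dec all? λ w → ¬? (star G v ⊂? star G w)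

G*-star-isMaximal : ∀ v → IsMaximalStar G* (star G* v)
G*-star-isMaximal = from-yes (all? λ v → isMaximalStar? G* (star G* v))

φ* : Fin 14 → ℚ
φ* e = + lookup weights e / 200
  where
  weights : Vec ℕ 14
  weights = 79 ∷ 63 ∷ 71 ∷ 41 ∷ 27 ∷ 86 ∷ 48 ∷ 78 ∷ 34 ∷ 87 ∷ 58 ∷ 66 ∷ 88 ∷ 74 ∷ []

φ*-star : ∀ v → sumOver φ* (star G* v) ≡ 1ℚ
φ*-star = from-yes (all? λ v → sumOver φ* (star G* v) ≟ 1ℚ)

φ*-sum≡1⇒isMaximalStar : ∀ F → sumOver φ* F ≡ 1ℚ → IsMaximalStar G* F
φ*-sum≡1⇒isMaximalStar F =
  decidable-stable (claim? F) (¬∃⟶∀¬ (from-no (anySubset? (¬? ∘ claim?))) F)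
  where
  claim? : Decidable (λ F → sumOver φ* F ≡ 1ℚ → IsMaximalStar G* F)
  claim? F = (sumOver φ* F ≟ 1ℚ) →-dec isMaximalStar? G* F

G*-equistarable : Equistarable G*
G*-equistarable =
  from-yes (all? (nonempty? ∘ star G*)) , φ* , from-yes (all? λ e → 0ℚ <? φ* e) , λ F →
  mk⇔ (λ { (v , refl , _) → φ*-star v })
      (φ*-sum≡1⇒isMaximalStar F)

-- the edges {9,1} and {3,7}
T : Subset 14
T = ⁅ # 8 ⁆ ∪ ⁅ # 11 ⁆

alternating : Fin 9 → ℚ
alternating = lookup (½ ∷ -½ ∷ ½ ∷ -½ ∷ ½ ∷ -½ ∷ ½ ∷ -½ ∷ ½ ∷ [])

alternatingStars≡T : ∀ e → ∑[ v < 9 ] (alternating v * indicator (star G* v) e) ≡ indicator T e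
alternatingStars≡T =
  from-yes (all? λ e → ∑[ v < 9 ] (alternating v * indicator (star G* v) e) ≟ indicator T e)

G*-¬stronglyEquistarable : ¬ StronglyEquistarable G*
G*-¬stronglyEquistarable = starCombination⇒¬stronglyEquistarable G* T alternating
  (from-yes (nonempty? T) , from-no (isMaximalStar? G* T))
  G*-star-isMaximal alternatingStars≡T (from-yes (∑[ v < 9 ] alternating v ≤? 1ℚ))

proposition11 : Equistarable G* × ¬ StronglyEquistarable G*
proposition11 = G*-equistarable , G*-¬stronglyEquistarable
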